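{- Let $X$ be a set and $\sigma$ a gradual subset of $X$. Then: (1) $\sigma^d$ is the largest strict decreasing gradual subset of $X$ contained in $\sigma^c$; (2) if $\sigma$ is decreasing, then $\sigma$ is not strict decreasing if and only if $\sigma^d\subsetneq\sigma^c$.
   Context: A gradual subset of $X$ is a map $\sigma:(0,1]\to\mathcal{P}(X)$; $\sigma_1\subseteq\sigma_2$ means $\sigma_1(\alpha)\subseteq\sigma_2(\alpha)$ for all $\alpha$. $\sigma$ is decreasing if $\sigma(\beta)\subseteq\sigma(\alpha)$ whenever $\alpha\leq\beta$. $\sigma^c(\alpha)=\bigcup\{\sigma(\beta)\mid\alpha\leq\beta\leq1\}$; $\sigma^d(1)=\sigma(1)$ and $\sigma^d(\alpha)=\bigcup\{\sigma(\beta)\mid\alpha<\beta\leq1\}$ for $\alpha<1$. A gradual subset $\tau$ is strict decreasing if $\tau=\tau^d$. -}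

module Defs where

open import Level using (0ℓ)
open import Data.Product using (Σ; ∃; _×_; _,_)
open import Data.Sum using (_⊎_)
open import Relation.Nullary using (¬_)
open import Relation.Binary.PropositionalEquality using (_≡_)
open import Relation.Binary.Structures using (IsTotalOrder)
open import Algebra.Structures using (IsCommutativeRing)

-- The real numbers, given axiomatically as a Dedekind-complete ordered field
-- (agda-stdlib has no reals).  Any model of this record is (classically) ℝ.
record RealNumbers : Set₁ where
  infixl 6 _+_
  infixl 7 _*_
  infix 4 _≤_ _<_
  field
    ℝ : Set
    _+_ _*_ : ℝ → ℝ → ℝ
    -_ : ℝ → ℝ
    0ℝ 1ℝ : ℝ
    isCommutativeRing : IsCommutativeRing _≡_ _+_ _*_ -_ 0ℝ 1ℝ
    0≢1 : ¬ (0ℝ ≡ 1ℝ)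
    inverse : ∀ x → ¬ (x ≡ 0ℝ) → Σ ℝ (λ y → x * y ≡ 1ℝ)
    _≤_ : ℝ → ℝ → Set
    isTotalOrder : IsTotalOrder _≡_ _≤_
    +-mono-≤ : ∀ {x y} z → x ≤ y → x + z ≤ y + z
    *-nonneg : ∀ {x y} → 0ℝ ≤ x → 0ℝ ≤ y → 0ℝ ≤ x * y
    complete : (P : ℝ → Set) → Σ ℝ P → Σ ℝ (λ b → ∀ x → P x → x ≤ b) →
               Σ ℝ (λ s → (∀ x → P x → x ≤ s) × (∀ b → (∀ x → P x → x ≤ b) → s ≤ b))

  _<_ : ℝ → ℝ → Set
  x < y = (x ≤ y) × ¬ (x ≡ y)

module Gradual (R : RealNumbers) where
  open RealNumbers R

  InI : ℝ → Set
  InI a = (0ℝ < a) × (a ≤ 1ℝ)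

  -- A gradual subset of X: a map (0,1] → 𝒫(X).  We represent it as a map on ℝ
  -- whose values outside (0,1] are ignored by every notion below; subsets of X
  -- are predicates X → Set.
  GradualSubset : Set → Set₁
  GradualSubset X = ℝ → X → Set

  _⊆g_ : {X : Set} → GradualSubset X → GradualSubset X → Set
  σ₁ ⊆g σ₂ = ∀ α → InI α → ∀ x → σ₁ α x → σ₂ α x

  _≐g_ : {X : Set} → GradualSubset X → GradualSubset X → Set
  σ₁ ≐g σ₂ = (σ₁ ⊆g σ₂) × (σ₂ ⊆g σ₁)

  _⊊g_ : {X : Set} → GradualSubset X → GradualSubset X → Set
  σ₁ ⊊g σ₂ = (σ₁ ⊆g σ₂) × ¬ (σ₁ ≐g σ₂)

  Decreasing : {X : Set} → GradualSubset X → Set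
  Decreasing σ = ∀ α β → InI α → InI β → α ≤ β → ∀ x → σ β x → σ α x

  _ᶜ : {X : Set} → GradualSubset X → GradualSubset X
  (σ ᶜ) α x = Σ ℝ (λ β → InI β × (α ≤ β) × σ β x)

  _ᵈ : {X : Set} → GradualSubset X → GradualSubset X
  (σ ᵈ) α x = ((α ≡ 1ℝ) × σ 1ℝ x)
            ⊎ (¬ (α ≡ 1ℝ) × Σ ℝ (λ β → InI β × (α < β) × σ β x))

  StrictDecreasing : {X : Set} → GradualSubset X → Set
  StrictDecreasing τ = τ ≐g (τ ᵈ)

-- The only property of the reals the argument needs is density of the
-- order: between any a < b there is some m with a < m < b.
module Submission where

open import Defs
open import Level using (0ℓ)
open import Data.Product using (_×_; _,_; proj₁; proj₂; Σ)
open import Data.Sum using (inj₁; inj₂)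
open import Data.Empty using (⊥-elim)
open import Relation.Nullary using (¬_)
open import Function.Bundles using (_⇔_; mk⇔)
open import Relation.Binary.PropositionalEquality
  using (_≡_; refl; sym; trans; cong; subst; subst₂; module ≡-Reasoning)
open import Relation.Binary.Structures using (IsTotalOrder)
open import Algebra.Bundles using (CommutativeRing)
import Algebra.Properties.AbelianGroup as AbelianGroupProperties
import Algebra.Properties.Ring as RingProperties

module Density (R : RealNumbers) where
  open RealNumbers R
  open Gradual R using (InI)
  open IsTotalOrder isTotalOrder using (antisym; total)
    renaming (refl to ≤-refl; trans to ≤-trans)

  -- The field axioms packaged as a library bundle, so that the generic
  -- group and ring lemmas of the standard library apply.
  ℝ-commutativeRing : CommutativeRing 0ℓ 0ℓ
  ℝ-commutativeRing = record
    { Carrier = ℝ ; _≈_ = _≡_ ; _+_ = _+_ ; _*_ = _*_ ; -_ = -_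
    ; 0# = 0ℝ ; 1# = 1ℝ ; isCommutativeRing = isCommutativeRing }

  open CommutativeRing ℝ-commutativeRing
    using (ring; +-abelianGroup; +-identityˡ; -‿inverseʳ; +-assoc; +-comm;
           *-identityˡ; *-identityʳ; distribˡ; distribʳ)
  open AbelianGroupProperties +-abelianGroup
    using (⁻¹-involutive; identityʳ-unique; x∙y⁻¹≈ε⇒x≈y; xyx⁻¹≈y)
  open RingProperties ring using (-1*x≈-x)
  open ≡-Reasoning

  ≤⇒0≤- : ∀ {x y} → x ≤ y → 0ℝ ≤ y + - x
  ≤⇒0≤- {x} p = subst (_≤ _) (-‿inverseʳ x) (+-mono-≤ (- x) p)

  <-≤-trans : ∀ {a b c} → a < b → b ≤ c → a < c
  <-≤-trans (a≤b , a≢b) b≤c =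
    ≤-trans a≤b b≤c , λ { refl → a≢b (antisym a≤b b≤c) }

  -- In an ordered ring 0 ≤ 1: otherwise 0 ≤ -1, hence 0 ≤ (-1)(-1) = 1.
  0≤1 : 0ℝ ≤ 1ℝ
  0≤1 with total 0ℝ 1ℝ
  ... | inj₁ 0≤1 = 0≤1
  ... | inj₂ 1≤0 = ⊥-elim (0≢1 (antisym 0≤1' 1≤0))
    where
    0≤-1 : 0ℝ ≤ - 1ℝ
    0≤-1 = subst (_ ≤_) (+-identityˡ (- 1ℝ)) (≤⇒0≤- 1≤0)
    [-1][-1]≡1 : (- 1ℝ) * (- 1ℝ) ≡ 1ℝ
    [-1][-1]≡1 = trans (-1*x≈-x (- 1ℝ)) (⁻¹-involutive 1ℝ)
    0≤1' : 0ℝ ≤ 1ℝ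
    0≤1' = subst (0ℝ ≤_) [-1][-1]≡1 (*-nonneg 0≤-1 0≤-1)

  -- 1 is a legitimate level, needed because σᵈ(1) and σᶜ(1) refer to σ(1).
  1∈I : InI 1ℝ
  1∈I = (0≤1 , 0≢1) , ≤-refl

  1≰0 : ¬ (1ℝ ≤ 0ℝ)
  1≰0 1≤0 = 0≢1 (antisym 0≤1 1≤0)

  two : ℝ
  two = 1ℝ + 1ℝ

  two≢0 : ¬ (two ≡ 0ℝ)
  two≢0 two≡0 = 1≰0 (subst₂ _≤_ (+-identityˡ 1ℝ) two≡0 (+-mono-≤ 1ℝ 0≤1))

  half : ℝ
  half = proj₁ (inverse two two≢0)

  half+half≡1 : half + half ≡ 1ℝ
  half+half≡1 = begin
    half + half             ≡⟨ cong (λ z → z + z) (sym (*-identityˡ half)) ⟩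
    1ℝ * half + 1ℝ * half   ≡⟨ sym (distribʳ half 1ℝ 1ℝ) ⟩
    two * half              ≡⟨ proj₂ (inverse two two≢0) ⟩
    1ℝ                      ∎

  -- If half ≤ 0 then 1 = half + half ≤ 0 + half ≤ 0.
  0≤half : 0ℝ ≤ half
  0≤half with total 0ℝ half
  ... | inj₁ 0≤h = 0≤h
  ... | inj₂ h≤0 = ⊥-elim (1≰0 (≤-trans 1≤0+h (subst (_≤ 0ℝ) (sym (+-identityˡ half)) h≤0)))
    where
    1≤0+h : 1ℝ ≤ 0ℝ + half
    1≤0+h = subst (_≤ 0ℝ + half) half+half≡1 (+-mono-≤ half h≤0)

  <-+-positive : ∀ {d} x → 0ℝ < d → x < x + d
  <-+-positive {d} x (0≤d , 0≢d) =
      subst₂ _≤_ (+-identityˡ x) (+-comm d x) (+-mono-≤ x 0≤d)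
    , λ x≡x+d → 0≢d (sym (identityʳ-unique x d (sym x≡x+d)))

  -- Density: m = a + d with d = (b - a)/2, so that a < a + d < a + d + d = b.
  density : ∀ {a b} → a < b → Σ ℝ (λ m → (a < m) × (m < b))
  density {a} {b} (a≤b , a≢b) =
    a + d , <-+-positive a 0<d , subst (a + d <_) a+d+d≡b (<-+-positive (a + d) 0<d)
    where
    d : ℝ
    d = (b + - a) * half

    d+d≡b-a : d + d ≡ b + - a
    d+d≡b-a = begin
      d + d                      ≡⟨ sym (distribˡ (b + - a) half half) ⟩
      (b + - a) * (half + half)  ≡⟨ cong ((b + - a) *_) half+half≡1 ⟩
      (b + - a) * 1ℝ             ≡⟨ *-identityʳ (b + - a) ⟩
      b + - a                    ∎

    0<d : 0ℝ < d
    0<d = *-nonneg (≤⇒0≤- a≤b) 0≤half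
        , λ 0≡d → a≢b (sym (x∙y⁻¹≈ε⇒x≈y b a (begin
            b + - a  ≡⟨ sym d+d≡b-a ⟩
            d + d    ≡⟨ cong (λ z → z + z) (sym 0≡d) ⟩
            0ℝ + 0ℝ  ≡⟨ +-identityˡ 0ℝ ⟩
            0ℝ       ∎)))

    a+d+d≡b : a + d + d ≡ b
    a+d+d≡b = begin
      a + d + d         ≡⟨ +-assoc a d d ⟩
      a + (d + d)       ≡⟨ cong (a +_) d+d≡b-a ⟩
      a + (b + - a)     ≡⟨ sym (+-assoc a b (- a)) ⟩
      a + b + - a       ≡⟨ xyx⁻¹≈y a b ⟩
      b                 ∎

module Closures (R : RealNumbers) where
  open RealNumbers R
  open Gradual R
  open Density R using (1∈I; density; <-≤-trans)
  open IsTotalOrder isTotalOrder using (antisym)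
    renaming (refl to ≤-refl; trans to ≤-trans)

  module _ {X : Set} where

    ⊆g-trans : {σ₁ σ₂ σ₃ : GradualSubset X} → σ₁ ⊆g σ₂ → σ₂ ⊆g σ₃ → σ₁ ⊆g σ₃
    ⊆g-trans p q α α∈I x s = q α α∈I x (p α α∈I x s)

    ≐g-sym : {σ₁ σ₂ : GradualSubset X} → σ₁ ≐g σ₂ → σ₂ ≐g σ₁
    ≐g-sym (p , q) = q , p

    ≐g-trans : {σ₁ σ₂ σ₃ : GradualSubset X} → σ₁ ≐g σ₂ → σ₂ ≐g σ₃ → σ₁ ≐g σ₃
    ≐g-trans (p , p') (q , q') = ⊆g-trans p q , ⊆g-trans q' p'

  module _ {X : Set} (σ : GradualSubset X) where

    -- σᵈ(α) collects levels β > α (or β = 1 = α), all of which count for σᶜ(α).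
    ᵈ⊆ᶜ : (σ ᵈ) ⊆g (σ ᶜ)
    ᵈ⊆ᶜ α _ x (inj₁ (refl , s))              = 1ℝ , 1∈I , ≤-refl , s
    ᵈ⊆ᶜ α _ x (inj₂ (_ , β , β∈I , α<β , s)) = β , β∈I , proj₁ α<β , s

    -- A witness level β > α is reached through an intermediate level
    -- α < m < β, which exists by density.
    ᵈ⊆ᵈᵈ : (σ ᵈ) ⊆g ((σ ᵈ) ᵈ)
    ᵈ⊆ᵈᵈ α _ x (inj₁ (α≡1 , s)) = inj₁ (α≡1 , inj₁ (refl , s))
    ᵈ⊆ᵈᵈ α (0<α , _) x (inj₂ (α≢1 , β , β∈I@(_ , β≤1) , α<β , s))
      with density α<β
    ... | m , α<m , m<β =
      inj₂ (α≢1 , m , m∈I , α<m , inj₂ (m≢1 , β , β∈I , m<β , s))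
      where
      m∈I : InI m
      m∈I = <-≤-trans 0<α (proj₁ α<m) , ≤-trans (proj₁ m<β) β≤1
      m≢1 : ¬ (m ≡ 1ℝ)
      m≢1 = proj₂ (<-≤-trans m<β β≤1)

    -- Two nested witness levels α < β < γ give the single witness γ.
    ᵈᵈ⊆ᵈ : ((σ ᵈ) ᵈ) ⊆g (σ ᵈ)
    ᵈᵈ⊆ᵈ α _ x (inj₁ (α≡1 , inj₁ (_ , s)))  = inj₁ (α≡1 , s)
    ᵈᵈ⊆ᵈ α _ x (inj₁ (α≡1 , inj₂ (1≢1 , _))) = ⊥-elim (1≢1 refl)
    ᵈᵈ⊆ᵈ α _ x (inj₂ (α≢1 , β , _ , α<β , inj₁ (refl , s))) =
      inj₂ (α≢1 , 1ℝ , 1∈I , α<β , s)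
    ᵈᵈ⊆ᵈ α _ x (inj₂ (α≢1 , β , _ , α<β , inj₂ (_ , γ , γ∈I , β<γ , s))) =
      inj₂ (α≢1 , γ , γ∈I , <-≤-trans α<β (proj₁ β<γ) , s)

    ᵈ-strictDecreasing : StrictDecreasing (σ ᵈ)
    ᵈ-strictDecreasing = ᵈ⊆ᵈᵈ , ᵈᵈ⊆ᵈ

    -- Maximality of σᵈ.
    ᵈ-largest : (τ : GradualSubset X) → τ ⊆g (τ ᵈ) → τ ⊆g (σ ᶜ) → τ ⊆g (σ ᵈ)
    ᵈ-largest τ τ⊆τᵈ τ⊆σᶜ α α∈I x t with τ⊆τᵈ α α∈I x t
    ... | inj₁ (α≡1 , t₁) with τ⊆σᶜ 1ℝ 1∈I x t₁
    ...   | γ , (_ , γ≤1) , 1≤γ , s =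
      inj₁ (α≡1 , subst (λ δ → σ δ x) (antisym γ≤1 1≤γ) s)
    ᵈ-largest τ τ⊆τᵈ τ⊆σᶜ α α∈I x t | inj₂ (α≢1 , β , β∈I , α<β , tβ)
      with τ⊆σᶜ β β∈I x tβ
    ... | γ , γ∈I , β≤γ , s = inj₂ (α≢1 , γ , γ∈I , <-≤-trans α<β β≤γ , s)

    decreasing⇒≐ᶜ : Decreasing σ → σ ≐g (σ ᶜ)
    decreasing⇒≐ᶜ dec =
        (λ α α∈I x s → α , α∈I , ≤-refl , s)
      , (λ α α∈I x (β , β∈I , α≤β , s) → dec α β α∈I β∈I α≤β x s)

    -- When σ = σᶜ, the equation σ = σᵈ says exactly σᵈ = σᶜ, and since
    -- σᵈ ⊆ σᶜ always holds, its failure is the same as σᵈ ⊊ σᶜ.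
    not-strict⇔ᵈ⊊ᶜ : σ ≐g (σ ᶜ) → (¬ StrictDecreasing σ) ⇔ ((σ ᵈ) ⊊g (σ ᶜ))
    not-strict⇔ᵈ⊊ᶜ σ≐σᶜ = mk⇔
      (λ not-strict → ᵈ⊆ᶜ , λ σᵈ≐σᶜ → not-strict (≐g-trans σ≐σᶜ (≐g-sym σᵈ≐σᶜ)))
      (λ (_ , σᵈ≢σᶜ) strict → σᵈ≢σᶜ (≐g-trans (≐g-sym strict) σ≐σᶜ))

mainTheorem10 : (R : RealNumbers) → (X : Set) → (σ : Gradual.GradualSubset R X) →
    let open Gradual R in
    (StrictDecreasing (σ ᵈ) × ((σ ᵈ) ⊆g (σ ᶜ))
    × ((τ : GradualSubset X) → StrictDecreasing τ → τ ⊆g (σ ᶜ) → τ ⊆g (σ ᵈ)))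
    × (Decreasing σ → ((¬ StrictDecreasing σ) ⇔ ((σ ᵈ) ⊊g (σ ᶜ))))
mainTheorem10 R X σ =
    ( ᵈ-strictDecreasing σ
    , ᵈ⊆ᶜ σ
    , (λ τ τ-strict → ᵈ-largest σ τ (proj₁ τ-strict)) )
  , (λ dec → not-strict⇔ᵈ⊊ᶜ σ (decreasing⇒≐ᶜ σ dec))
  where open Closures R
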